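{- Let $G$ be a nontrivial traceable graph and let $H$ be a connected graph whose maximum degree equals $|V(H)|-2$. Then $tpc(G\square H)=3$.
   Context: All graphs are simple, finite and undirected. A graph is traceable if it has a Hamiltonian path (a path containing every vertex); nontrivial means having at least two vertices. A graph is total-colored if all its vertices and edges are assigned colors. A path in a total-colored graph is a total proper path if (i) any two adjacent edges on the path differ in color, (ii) any two adjacent internal vertices of the path differ in color, and (iii) every internal vertex of the path differs in color from the edges of the path incident with it. A total-colored graph is total-proper connected if any two vertices are joined by a total proper path. For a connected graph $G$, $tpc(G)$ is the smallest number of colors in a total-coloring making $G$ total-proper connected. The Cartesian product $G\square H$ has vertex set $V(G)\times V(H)$, with $(g,h)$ adjacent to $(g',h')$ iff either $g=g'$ and $hh'\in E(H)$, or $h=h'$ and $gg'\in E(G)$. -}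

module Defs where

open import Data.Nat using (ℕ; zero; suc; _+_; _≤_; _<_)
open import Data.Fin using (Fin)
open import Data.Bool using (Bool; true; false; if_then_else_)
open import Data.List using (List; []; _∷_; map; allFin)
open import Data.Nat.ListAction using (sum)
open import Data.Empty using (⊥)
open import Data.List.Relation.Unary.Linked using (Linked)
open import Data.List.Relation.Unary.Unique.Propositional using (Unique)
open import Data.List.Membership.Propositional using (_∈_)
open import Data.Product using (Σ; _×_; ∃; _,_)
open import Data.Sum using (_⊎_)
open import Data.Unit using (⊤)
open import Relation.Nullary using (¬_)
open import Relation.Binary.PropositionalEquality using (_≡_; _≢_)

record Graph : Set where
  field
    n     : ℕ
    adj   : Fin n → Fin n → Bool
    sym   : ∀ u v → adj u v ≡ adj v u
    irrefl : ∀ v → adj v v ≡ false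
open Graph public

Adj : (G : Graph) → Fin (n G) → Fin (n G) → Set
Adj G u v = adj G u v ≡ true

module _ {V : Set} (A : V → V → Set) where

  lastOf : V → List V → V
  lastOf a []       = a
  lastOf a (b ∷ bs) = lastOf b bs

  IsPath : V → V → List V → Set
  IsPath u v []       = ⊥
  IsPath u v (x ∷ xs) = (x ≡ u) × (lastOf x xs ≡ v) × Unique (x ∷ xs) × Linked A (x ∷ xs)

  Connected : Set
  Connected = ∀ u v → ∃ λ xs → IsPath u v xs

  -- total colourings with colours from Fin k: every vertex and every edge gets a colour;
  -- the edge colour is given by a function of the ordered pair that is symmetric on edges
  record TotalColoring (k : ℕ) : Set where
    field
      vcol : V → Fin k
      ecol : V → V → Fin k
      esym : ∀ u v → A u v → ecol u v ≡ ecol v u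

  module _ {k : ℕ} (c : TotalColoring k) where
    open TotalColoring c

    Triples : List V → Set
    Triples (a ∷ b ∷ d ∷ rest) =
      (ecol a b ≢ ecol b d) × (vcol b ≢ ecol a b) × (vcol b ≢ ecol b d)
      × Triples (b ∷ d ∷ rest)
    Triples _ = ⊤

    -- two adjacent internal vertices b d (window a b d e) differ in colour
    Quads : List V → Set
    Quads (a ∷ b ∷ d ∷ e ∷ rest) = (vcol b ≢ vcol d) × Quads (b ∷ d ∷ e ∷ rest)
    Quads _ = ⊤

    IsTotalProperPath : V → V → List V → Set
    IsTotalProperPath u v xs = IsPath u v xs × Triples xs × Quads xs

    TotalProperConnected : Set
    TotalProperConnected = ∀ u v → ∃ λ xs → IsTotalProperPath u v xs

  TpcEquals : ℕ → Set
  TpcEquals k =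
    (Σ (TotalColoring k) TotalProperConnected)
    × (∀ j → j < k → ¬ Σ (TotalColoring j) TotalProperConnected)

Traceable : Graph → Set
Traceable G = ∃ λ xs → Unique xs × Linked (Adj G) xs × (∀ v → v ∈ xs)

Nontrivial : Graph → Set
Nontrivial G = 2 ≤ n G

ConnectedG : Graph → Set
ConnectedG G = Connected (Adj G)

degree : (G : Graph) → Fin (n G) → ℕ
degree G v = sum (map (λ w → if adj G v w then 1 else 0) (allFin (n G)))

-- maximum degree Δ(G) equals |V(G)| - 2  (written Δ + 2 = |V|)
MaxDegreeIsOrderMinus2 : Graph → Set
MaxDegreeIsOrderMinus2 G =
  (∀ v → degree G v + 2 ≤ n G) × (∃ λ v → degree G v + 2 ≡ n G)

ProdAdj : (G H : Graph) → Fin (n G) × Fin (n H) → Fin (n G) × Fin (n H) → Set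
ProdAdj G H (g , h) (g' , h') =
  ((g ≡ g') × Adj H h h') ⊎ ((h ≡ h') × Adj G g g')

module Submission where

-- Lower bound: (a , w) and (b , z) with a ≠ b and w ≠ z are distinct and not
-- adjacent, so a total proper path between them has an internal vertex whose
-- colour and the colours of its two path edges are pairwise different.
--
-- Upper bound: give every vertex a potential p in ℤ₃ and colour a vertex by 2p
-- and an edge by the sum of the potentials of its ends. Along any walk on which
-- p rises by one at each step (an ascent) the result is total proper once the
-- walk is shortened to a path, and so is the reverse of an ascent. It thus
-- suffices that every vertex ascends to a hub and the hub ascends to every vertex.
-- The potential of (g , h) depends on the position of g along a Hamiltonian path
-- of G (its row) and on the role of h in a spider inside H: a vertex w of maximum
-- degree sees all vertices but one, z, and z has a neighbour y. Rows are grouped in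
-- blocks of three where the columns of w and z rise and the leaf columns fall;
-- one or two extra rows on top handle |V(G)| ≢ 0 (mod 3).

open import Defs hiding (sym)

open import Data.Nat using (ℕ; zero; suc; _+_; _∸_; _≤_; _<_; _≤′_; ≤′-refl; ≤′-step; z≤n; s≤s)
open import Data.Nat.Properties using (≤-refl; ≤-reflexive; ≤-trans; <⇒≤; m≤n⇒m≤1+n; ≤⇒≤′; +-suc; +-cancelˡ-≡; +-monoˡ-≤; n≮n; _<?_; m+n≮n; m+n∸n≡m; m≤n⇒m<n∨m≡n; ≤-pred)
open import Data.Bool using (Bool; true; false; not; if_then_else_)
import Data.Bool as Bool
open import Data.Bool.Properties using (not-injective)
open import Data.Fin using (Fin; zero; suc; _≟_)
open import Data.Fin.Properties using (any?; pigeonhole)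
open import Data.List using (List; []; _∷_; _++_; length; map; filter; allFin)
open import Data.List.Properties using (length-++-sucʳ; length-tabulate)
open import Data.Nat.ListAction using (sum)
open import Data.List.Membership.Propositional.Properties
  using (∈-∃++; ∈-++⁻; ∈-++⁺ˡ; ∈-++⁺ʳ; ∈-filter⁺; ∈-filter⁻; ∈-allFin)
open import Data.List.Relation.Unary.Unique.Propositional.Properties as Unique using (allFin⁺)
open import Data.List.Relation.Unary.Linked using (Linked; []; [-]; _∷_)
open import Data.List.Relation.Unary.AllPairs using ([]; _∷_)
open import Data.List.Relation.Unary.All as All using ([]; _∷_)
open import Data.List.Relation.Unary.All.Properties using (¬Any⇒All¬)
open import Data.List.Relation.Unary.Any using (here; there)
open import Data.List.Relation.Unary.Unique.Propositional using (Unique)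
open import Data.List.Membership.Propositional using (_∈_)
open import Data.Product using (Σ; ∃; _×_; _,_; proj₁; proj₂)
open import Data.Sum using (_⊎_; inj₁; inj₂)
open import Data.Unit using (tt)
open import Data.Empty using (⊥; ⊥-elim)
open import Relation.Nullary using (¬_; Dec; yes; no)
open import Relation.Nullary.Decidable using (¬?; _×-dec_)
open import Relation.Binary.Definitions using (DecidableEquality)
open import Relation.Binary.PropositionalEquality
  using (_≡_; _≢_; refl; sym; trans; cong; cong₂; cong-app; subst)
open import Relation.Binary.Construct.Closure.ReflexiveTransitive using (Star; ε; _◅_; _◅◅_)

ℤ₃ : Set
ℤ₃ = Fin 3

suc₃ : ℤ₃ → ℤ₃
suc₃ zero = suc zero
suc₃ (suc zero) = suc (suc zero)
suc₃ (suc (suc zero)) = zero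

_⊕_ : ℤ₃ → ℤ₃ → ℤ₃
zero ⊕ y = y
suc zero ⊕ y = suc₃ y
suc (suc zero) ⊕ y = suc₃ (suc₃ y)

⊕-comm : ∀ x y → x ⊕ y ≡ y ⊕ x
⊕-comm zero zero = refl
⊕-comm zero (suc zero) = refl
⊕-comm zero (suc (suc zero)) = refl
⊕-comm (suc zero) zero = refl
⊕-comm (suc zero) (suc zero) = refl
⊕-comm (suc zero) (suc (suc zero)) = refl
⊕-comm (suc (suc zero)) zero = refl
⊕-comm (suc (suc zero)) (suc zero) = refl
⊕-comm (suc (suc zero)) (suc (suc zero)) = refl

suc₃-cube : ∀ r → suc₃ (suc₃ (suc₃ r)) ≡ r
suc₃-cube zero = refl
suc₃-cube (suc zero) = refl
suc₃-cube (suc (suc zero)) = refl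

suc₃-inverse : ∀ {x y} → y ≡ suc₃ x → x ≡ suc₃ (suc₃ y)
suc₃-inverse {zero} refl = refl
suc₃-inverse {suc zero} refl = refl
suc₃-inverse {suc (suc zero)} refl = refl

-- The arithmetic heart of the upper bound: if the potentials x, y, z of three
-- consecutive vertices increase by a fixed nonzero δ, then the colouring
-- "vertex ↦ 2·potential, edge ↦ sum of the end potentials" satisfies every
-- condition a total proper path imposes around the middle vertex.
window : ∀ δ → δ ≢ zero → ∀ x → let y = δ ⊕ x ; z = δ ⊕ y in
         (x ⊕ y ≢ y ⊕ z) × (y ⊕ y ≢ x ⊕ y) × (y ⊕ y ≢ y ⊕ z) × (x ⊕ x ≢ y ⊕ y)
window zero δ≢0 _ = ⊥-elim (δ≢0 refl)
window (suc zero) _ zero = (λ ()) , (λ ()) , (λ ()) , (λ ())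
window (suc zero) _ (suc zero) = (λ ()) , (λ ()) , (λ ()) , (λ ())
window (suc zero) _ (suc (suc zero)) = (λ ()) , (λ ()) , (λ ()) , (λ ())
window (suc (suc zero)) _ zero = (λ ()) , (λ ()) , (λ ()) , (λ ())
window (suc (suc zero)) _ (suc zero) = (λ ()) , (λ ()) , (λ ()) , (λ ())
window (suc (suc zero)) _ (suc (suc zero)) = (λ ()) , (λ ()) , (λ ()) , (λ ())

module PotentialColouring {V : Set} (A : V → V → Set) (p : V → ℤ₃) where

  colouring : TotalColoring A 3
  colouring = record
    { vcol = λ v → p v ⊕ p v
    ; ecol = λ u v → p u ⊕ p v
    ; esym = λ u v _ → ⊕-comm (p u) (p v)
    }

  Step : ℤ₃ → V → V → Set
  Step δ a b = A a b × p b ≡ δ ⊕ p a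

  steps-are-edges : ∀ {δ L} → Linked (Step δ) L → Linked A L
  steps-are-edges [] = []
  steps-are-edges [-] = [-]
  steps-are-edges {δ} ((ab , _) ∷ k) = ab ∷ steps-are-edges {δ} k

  module _ {δ : ℤ₃} (δ≢0 : δ ≢ zero) where

    private
      window-at : ∀ {x y z} → y ≡ δ ⊕ x → z ≡ δ ⊕ y →
                  (x ⊕ y ≢ y ⊕ z) × (y ⊕ y ≢ x ⊕ y) × (y ⊕ y ≢ y ⊕ z) × (x ⊕ x ≢ y ⊕ y)
      window-at {x} refl refl = window δ δ≢0 x

    steps-triples : ∀ {L} → Linked (Step δ) L → Triples A colouring L
    steps-triples [] = tt
    steps-triples [-] = tt
    steps-triples (_ ∷ [-]) = tt
    steps-triples ((_ , pb) ∷ bd@(_ , pd) ∷ k) =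
      let (e≢e , v≢e₁ , v≢e₂ , _) = window-at pb pd
      in e≢e , v≢e₁ , v≢e₂ , steps-triples (bd ∷ k)

    steps-quads : ∀ {L} → Linked (Step δ) L → Quads A colouring L
    steps-quads [] = tt
    steps-quads [-] = tt
    steps-quads (_ ∷ [-]) = tt
    steps-quads (_ ∷ _ ∷ [-]) = tt
    steps-quads (_ ∷ bd@(_ , pd) ∷ de@(_ , pe) ∷ k) =
      proj₂ (proj₂ (proj₂ (window-at pd pe))) , steps-quads (bd ∷ de ∷ k)

-- Every walk contains a path with the same end points: cut out closed subwalks.
module Shortcut {V : Set} (R : V → V → Set) (_≟_ : DecidableEquality V) where

  open import Data.List.Membership.DecPropositional _≟_ using (_∈?_)

  PathFrom : V → V → Set
  PathFrom u v = Σ (List V) λ rest → (lastOf R u rest ≡ v) × Unique (u ∷ rest) × Linked R (u ∷ rest)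

  suffix : ∀ {a u v} rest → lastOf R a rest ≡ v → Unique (a ∷ rest) → Linked R (a ∷ rest) →
           u ∈ a ∷ rest → PathFrom u v
  suffix rest last uniq link (here refl) = rest , last , uniq , link
  suffix (_ ∷ rest) last (_ ∷ uniq) (_ ∷ link) (there u∈rest) = suffix rest last uniq link u∈rest

  shortcut : ∀ {u v} → Star R u v → PathFrom u v
  shortcut ε = [] , refl , [] ∷ [] , [-]
  shortcut {u} (_◅_ {j = w} uw walk) with shortcut walk
  ... | rest , last , uniq , link with u ∈? w ∷ rest
  ...   | yes u∈path = suffix rest last uniq link u∈path
  ...   | no u∉path = w ∷ rest , last , ¬Any⇒All¬ _ u∉path ∷ uniq , uw ∷ link

-- Total proper connectivity from a hub: if every vertex ascends (potential +1 per
-- step) to a hub, and the hub ascends to every vertex outside a set S of pairwise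
-- adjacent vertices, then any two vertices are joined by a total proper path:
-- ascend through the hub, or reverse such a walk into a descending one.
module HubConnection {V : Set} (A : V → V → Set) (A-sym : ∀ {a b} → A a b → A b a)
                     (_≟_ : DecidableEquality V) (p : V → ℤ₃) where

  open PotentialColouring A p

  Ascent : V → V → Set
  Ascent = Star (Step (suc zero))

  Descent : V → V → Set
  Descent = Star (Step (suc (suc zero)))

  reverse : ∀ {a b} → Ascent a b → Descent b a
  reverse ε = ε
  reverse ((ab , pb) ◅ walk) = reverse walk ◅◅ ((A-sym ab , suc₃-inverse pb) ◅ ε)

  proper : ∀ {δ u v} → δ ≢ zero → Shortcut.PathFrom (Step δ) _≟_ u v →
           ∃ λ xs → IsTotalProperPath A colouring u v xs
  proper {δ} {u} δ≢0 (rest , last , uniq , link) =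
    u ∷ rest , (refl , last , uniq , steps-are-edges {δ} link) , steps-triples δ≢0 link , steps-quads δ≢0 link

  hub-connected : (hub : V) (S : V → Set) →
                  (∀ v → Ascent v hub) → (∀ v → Ascent hub v ⊎ S v) →
                  (∀ u v → S u → S v → u ≢ v → A u v) →
                  TotalProperConnected A colouring
  hub-connected hub S to-hub from-hub clique u v with from-hub v | from-hub u
  ... | inj₁ hub⇝v | _ = proper {suc zero} (λ ()) (Shortcut.shortcut _ _≟_ (to-hub u ◅◅ hub⇝v))
  ... | inj₂ _ | inj₁ hub⇝u =
    proper {suc (suc zero)} (λ ()) (Shortcut.shortcut _ _≟_ (reverse (to-hub v ◅◅ hub⇝u)))
  ... | inj₂ Sv | inj₂ Su with u ≟ v
  ...   | yes refl = u ∷ [] , (refl , refl , [] ∷ [] , [-]) , tt , tt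
  ...   | no u≢v = u ∷ v ∷ [] , (refl , refl , (u≢v ∷ []) ∷ [] ∷ [] , clique u v Su Sv u≢v ∷ [-]) , tt , tt

module Counting {A : Set} where

  count : (A → Bool) → List A → ℕ
  count f L = sum (map (λ a → if f a then 1 else 0) L)

  count-complement : ∀ (f : A → Bool) L → count f L + count (λ a → not (f a)) L ≡ length L
  count-complement f [] = refl
  count-complement f (a ∷ L) with f a
  ... | true = cong suc (count-complement f L)
  ... | false = trans (+-suc (count f L) _) (cong suc (count-complement f L))

  length-≤-of-⊆ : ∀ {xs ys : List A} → Unique xs → (∀ {x} → x ∈ xs → x ∈ ys) → length xs ≤ length ys
  length-≤-of-⊆ {[]} _ _ = z≤n
  length-≤-of-⊆ {x ∷ xs} (x∉xs ∷ uniq) xs⊆ys with ∈-∃++ (xs⊆ys (here refl))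
  ... | ys₁ , ys₂ , refl =
    ≤-trans (s≤s (length-≤-of-⊆ uniq xs⊆ys₁ys₂)) (≤-reflexive (sym (length-++-sucʳ ys₁ x ys₂)))
    where
      xs⊆ys₁ys₂ : ∀ {a} → a ∈ xs → a ∈ ys₁ ++ ys₂
      xs⊆ys₁ys₂ a∈xs with ∈-++⁻ ys₁ (xs⊆ys (there a∈xs))
      ... | inj₁ a∈ys₁ = ∈-++⁺ˡ a∈ys₁
      ... | inj₂ (here refl) = ⊥-elim (All.lookup x∉xs a∈xs refl)
      ... | inj₂ (there a∈ys₂) = ∈-++⁺ʳ ys₁ a∈ys₂

  private
    holds? : (f : A → Bool) → (a : A) → Dec (f a ≡ true)
    holds? f a = f a Bool.≟ true

    count-filter : ∀ f L → count f L ≡ length (filter (holds? f) L)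
    count-filter f [] = refl
    count-filter f (a ∷ L) with f a
    ... | true = cong suc (count-filter f L)
    ... | false = count-filter f L

  count-lower : ∀ {f K L} → Unique K → (∀ {k} → k ∈ K → k ∈ L × f k ≡ true) → length K ≤ count f L
  count-lower {f} {K} {L} uniq K⊆ =
    subst (length K ≤_) (sym (count-filter f L))
          (length-≤-of-⊆ uniq (λ k∈K → ∈-filter⁺ (holds? f) (proj₁ (K⊆ k∈K)) (proj₂ (K⊆ k∈K))))

  count-upper : ∀ {f K L} → Unique L → (∀ {u} → u ∈ L → f u ≡ true → u ∈ K) → count f L ≤ length K
  count-upper {f} {K} {L} uniq ⊆K =
    subst (_≤ length K) (sym (count-filter f L))
          (length-≤-of-⊆ (Unique.filter⁺ (holds? f) uniq)
                          (λ u∈ → let (u∈L , fu) = ∈-filter⁻ (holds? f) u∈ in ⊆K u∈L fu))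

module _ (G : Graph) where

  adj-sym : ∀ {a b} → Adj G a b → Adj G b a
  adj-sym {a} {b} ab = trans (Graph.sym G b a) ab

  adj-≢ : ∀ {a b} → Adj G a b → a ≢ b
  adj-≢ {a} ab refl with trans (sym ab) (irrefl G a)
  ... | ()

record Spider (H : Graph) : Set where
  field
    w y z x : Fin (n H)
    w∼others : ∀ u → u ≢ w → u ≢ z → Adj H w u
    y∼z : Adj H y z
    z≢w : z ≢ w
    y≢w : y ≢ w
    y≢z : y ≢ z
    x≢w : x ≢ w
    x≢y : x ≢ y
    x≢z : x ≢ z

-- A connected graph with Δ(H) = |V(H)| − 2 contains such a spider: take w of
-- maximum degree; counting non-neighbours gives z and shows w sees every other
-- vertex, connectivity gives y, and |V(H)| ≥ 4 (y has degree ≥ 2) gives x.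
spider : (H : Graph) → ConnectedG H → MaxDegreeIsOrderMinus2 H → Spider H
spider H connected (deg≤ , w , deg-w) = record
  { w = w ; y = y ; z = z ; x = proj₁ fourth
  ; w∼others = w∼others ; y∼z = y∼z ; z≢w = z≢w ; y≢w = y≢w ; y≢z = adj-≢ H y∼z
  ; x≢w = proj₁ (proj₂ fourth) ; x≢y = proj₁ (proj₂ (proj₂ fourth)) ; x≢z = proj₂ (proj₂ (proj₂ fourth))
  }
  where
    open Counting

    vertices : List (Fin (n H))
    vertices = allFin (n H)

    -- besides itself, w has exactly one non-neighbour
    non-neighbours : count (λ u → not (adj H w u)) vertices ≡ 2
    non-neighbours = +-cancelˡ-≡ (degree H w) _ _
      (trans (count-complement (adj H w) vertices)
             (trans (length-tabulate (λ u → u)) (sym deg-w)))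

    far : ∃ λ z → z ≢ w × adj H w z ≡ false
    far with any? (λ u → ¬? (u ≟ w) ×-dec (adj H w u Bool.≟ false))
    ... | yes found = found
    ... | no none = ⊥-elim (n≮n 1 (subst (_≤ 1) non-neighbours (count-upper (allFin⁺ (n H)) only-w)))
      where
        only-w : ∀ {u} → u ∈ vertices → not (adj H w u) ≡ true → u ∈ w ∷ []
        only-w {u} _ w≁u with u ≟ w
        ... | yes refl = here refl
        ... | no u≢w = ⊥-elim (none (u , u≢w , not-injective w≁u))

    z : Fin (n H)
    z = proj₁ far

    z≢w : z ≢ w
    z≢w = proj₁ (proj₂ far)

    w≁z : adj H w z ≡ false
    w≁z = proj₂ (proj₂ far)

    w∼others : ∀ u → u ≢ w → u ≢ z → Adj H w u
    w∼others u u≢w u≢z with adj H w u in w∼u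
    ... | true = refl
    ... | false = ⊥-elim (n≮n 2 (subst (3 ≤_) non-neighbours (count-lower three-distinct non-adjacent)))
      where
        three-distinct : Unique (w ∷ u ∷ z ∷ [])
        three-distinct = ((λ e → u≢w (sym e)) ∷ (λ e → z≢w (sym e)) ∷ []) ∷ (u≢z ∷ []) ∷ [] ∷ []

        non-adjacent : ∀ {k} → k ∈ w ∷ u ∷ z ∷ [] → k ∈ vertices × not (adj H w k) ≡ true
        non-adjacent (here refl) = ∈-allFin w , cong not (irrefl H w)
        non-adjacent (there (here refl)) = ∈-allFin u , cong not w∼u
        non-adjacent (there (there (here refl))) = ∈-allFin z , cong not w≁z

    -- the second vertex of a path from z to w is a neighbour of z
    near : ∃ λ y → Adj H y z
    near with connected z w
    ... | _ ∷ [] , refl , z≡w , _ = ⊥-elim (z≢w z≡w)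
    ... | _ ∷ y ∷ _ , refl , _ , _ , z∼y ∷ _ = y , adj-sym H z∼y

    y : Fin (n H)
    y = proj₁ near

    y∼z : Adj H y z
    y∼z = proj₂ near

    y≢w : y ≢ w
    y≢w y≡w with trans (sym (subst (λ v → Adj H v z) y≡w y∼z)) w≁z
    ... | ()

    fourth : ∃ λ x → x ≢ w × x ≢ y × x ≢ z
    fourth with any? (λ u → ¬? (u ≟ w) ×-dec ¬? (u ≟ y) ×-dec ¬? (u ≟ z))
    ... | yes found = found
    ... | no none = ⊥-elim (n≮n 3 (≤-trans at-least-four at-most-three))
      where
        -- otherwise y is the only neighbour of w, so |V(H)| = deg w + 2 ≤ 3 ...
        only-y : ∀ {u} → u ∈ vertices → adj H w u ≡ true → u ∈ y ∷ []
        only-y {u} _ w∼u with u ≟ y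
        ... | yes refl = here refl
        ... | no u≢y = ⊥-elim (none (u , (λ e → adj-≢ H w∼u (sym e)) , u≢y , u≢z))
          where
            u≢z : u ≢ z
            u≢z refl with trans (sym w∼u) w≁z
            ... | ()

        at-most-three : n H ≤ 3
        at-most-three = subst (_≤ 3) deg-w (+-monoˡ-≤ 2 (count-upper (allFin⁺ (n H)) only-y))

        -- ... while y is adjacent to both w and z, so |V(H)| ≥ deg y + 2 ≥ 4
        two-neighbours : 2 ≤ degree H y
        two-neighbours = count-lower (((λ e → z≢w (sym e)) ∷ []) ∷ [] ∷ [])
          (λ { (here refl) → ∈-allFin w , adj-sym H (w∼others y y≢w (adj-≢ H y∼z))
             ; (there (here refl)) → ∈-allFin z , y∼z })

        at-least-four : 4 ≤ n H
        at-least-four = ≤-trans (+-monoˡ-≤ 2 two-neighbours) (deg≤ y)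

module Positions {A : Set} (default : A) where

  nth : List A → ℕ → A
  nth [] _ = default
  nth (a ∷ L) zero = a
  nth (a ∷ L) (suc i) = nth L i

  position : ∀ {a : A} {L} → a ∈ L → ℕ
  position (here _) = zero
  position (there a∈L) = suc (position a∈L)

  nth-position : ∀ {a L} (a∈L : a ∈ L) → nth L (position a∈L) ≡ a
  nth-position (here refl) = refl
  nth-position (there a∈L) = nth-position a∈L

  position< : ∀ {a L} (a∈L : a ∈ L) → position a∈L < length L
  position< (here _) = s≤s z≤n
  position< (there a∈L) = s≤s (position< a∈L)

  nth∈ : ∀ L i → i < length L → nth L i ∈ L
  nth∈ (a ∷ L) zero _ = here refl
  nth∈ (a ∷ L) (suc i) (s≤s i<) = there (nth∈ L i i<)

  position-nth : ∀ L → Unique L → ∀ i → i < length L → (a∈L : nth L i ∈ L) → position a∈L ≡ i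
  position-nth (a ∷ L) _ zero _ (here _) = refl
  position-nth (a ∷ L) (a∉L ∷ _) zero _ (there a∈L) = ⊥-elim (All.lookup a∉L a∈L refl)
  position-nth (a ∷ L) (a∉L ∷ _) (suc i) (s≤s i<) (here e) =
    ⊥-elim (All.lookup a∉L (subst (_∈ L) e (nth∈ L i i<)) refl)
  position-nth (a ∷ L) (_ ∷ uniq) (suc i) (s≤s i<) (there a∈L) = cong suc (position-nth L uniq i i< a∈L)

  nth-linked : ∀ {R : A → A → Set} L → Linked R L → ∀ i → suc i < length L → R (nth L i) (nth L (suc i))
  nth-linked (a ∷ []) [-] zero (s≤s ())
  nth-linked (a ∷ b ∷ L) (r ∷ _) zero _ = r
  nth-linked (a ∷ b ∷ L) (_ ∷ link) (suc i) (s≤s i<) = nth-linked (b ∷ L) link i i<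

module _ {V : Set} {R : V → V → Set} (f : ℕ → V) where

  private
    climb′ : ∀ {i j} → (∀ k → k < j → Star R (f k) (f (suc k))) → i ≤′ j → Star R (f i) (f j)
    climb′ step ≤′-refl = ε
    climb′ step (≤′-step i≤′j) = climb′ (λ k k< → step k (m≤n⇒m≤1+n k<)) i≤′j ◅◅ step _ ≤-refl

    descend′ : ∀ {i j} → (∀ k → k < j → Star R (f (suc k)) (f k)) → i ≤′ j → Star R (f j) (f i)
    descend′ step ≤′-refl = ε
    descend′ step (≤′-step i≤′j) = step _ ≤-refl ◅◅ descend′ (λ k k< → step k (m≤n⇒m≤1+n k<)) i≤′j

  climb : ∀ {i j} → (∀ k → k < j → Star R (f k) (f (suc k))) → i ≤ j → Star R (f i) (f j)
  climb step i≤j = climb′ step (≤⇒≤′ i≤j)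

  descend : ∀ {i j} → (∀ k → k < j → Star R (f (suc k)) (f k)) → i ≤ j → Star R (f j) (f i)
  descend step i≤j = descend′ step (≤⇒≤′ i≤j)

below-or-last : ∀ {i k} → i < suc (suc k) → (i ≤ k) ⊎ (i ≡ suc k)
below-or-last i<k+2 with m≤n⇒m<n∨m≡n (≤-pred i<k+2)
... | inj₁ i<k+1 = inj₁ (≤-pred i<k+1)
... | inj₂ i≡k+1 = inj₂ i≡k+1

two-vertex-complete : (G : Graph) {xs : List (Fin (n G))} → length xs ≡ 2 → Linked (Adj G) xs →
                      (∀ g → g ∈ xs) → ∀ g g′ → g ≢ g′ → Adj G g g′
two-vertex-complete G {_ ∷ _ ∷ []} _ (a∼b ∷ _) cover g g′ g≢g′ with cover g | cover g′
... | here refl | here refl = ⊥-elim (g≢g′ refl)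
... | here refl | there (here refl) = a∼b
... | there (here refl) | here refl = adj-sym G a∼b
... | there (here refl) | there (here refl) = ⊥-elim (g≢g′ refl)

-- Row patterns for the potential on G □ H. The vertices of H fall into four
-- classes: the centre w, the neighbour y of z, the far vertex z, and the rest X.
data Class : Set where
  W Y Z X : Class

Pattern : Set
Pattern = Class → ℤ₃

-- mirror r = −1 − r
mirror : ℤ₃ → ℤ₃
mirror zero = suc (suc zero)
mirror (suc zero) = suc zero
mirror (suc (suc zero)) = zero

mirror-falls : ∀ r → mirror r ≡ suc₃ (mirror (suc₃ r))
mirror-falls zero = refl
mirror-falls (suc zero) = refl
mirror-falls (suc (suc zero)) = refl

residue : ℕ → ℤ₃
residue zero = zero
residue (suc i) = suc₃ (residue i)

-- Base rows: along the Hamiltonian path of G the potential rises by one per row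
-- in the columns W and Z and falls by one per row in the leaf columns Y and X.
base : ℤ₃ → Pattern
base r W = r
base r Z = r
base r Y = mirror r
base r X = mirror r

cap₁ cap₂ᵃ cap₂ᵇ : Pattern
cap₁ W = suc (suc zero)
cap₁ Y = zero
cap₁ Z = suc zero
cap₁ X = suc zero
cap₂ᵃ W = zero
cap₂ᵃ Y = suc zero
cap₂ᵃ Z = zero
cap₂ᵃ X = suc (suc zero)
cap₂ᵇ W = zero
cap₂ᵇ Y = suc (suc zero)
cap₂ᵇ Z = suc zero
cap₂ᵇ X = suc zero

profile : ℕ → (ℕ → Pattern) → ℕ → Pattern
profile b cap i with i <? b
... | yes _ = base (residue i)
... | no _ = cap (i ∸ b)

profile-base : ∀ {b cap i} → i < b → profile b cap i ≡ base (residue i)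
profile-base {b} {cap} {i} i<b with i <? b
... | yes _ = refl
... | no i≮b = ⊥-elim (i≮b i<b)

profile-cap : ∀ b cap j → profile b cap (j + b) ≡ cap j
profile-cap b cap j with j + b <? b
... | yes j+b<b = ⊥-elim (m+n≮n j b j+b<b)
... | no _ = cong cap (m+n∸n≡m j b)

two-row-cap : ℕ → Pattern
two-row-cap zero = cap₂ᵃ
two-row-cap (suc _) = cap₂ᵇ

Shape : ℕ → Set
Shape m = (m ≡ 2) ⊎ (∃ λ top → residue top ≡ suc (suc zero) ×
                                 ((m ≡ suc top) ⊎ (m ≡ 2 + top) ⊎ (m ≡ 3 + top)))

length-cases : ∀ m → 2 ≤ m → Shape m
length-cases (suc zero) (s≤s ())
length-cases (suc (suc zero)) _ = inj₁ refl
length-cases (suc (suc (suc k))) _ = inj₂ (blocks k)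
  where
    blocks : ∀ k → ∃ λ top → residue top ≡ suc (suc zero) ×
                              ((3 + k ≡ suc top) ⊎ (3 + k ≡ 2 + top) ⊎ (3 + k ≡ 3 + top))
    blocks zero = 2 , refl , inj₁ refl
    blocks (suc k) with blocks k
    ... | top , r , inj₁ e = top , r , inj₂ (inj₁ (cong suc e))
    ... | top , r , inj₂ (inj₁ e) = top , r , inj₂ (inj₂ (cong suc e))
    ... | top , r , inj₂ (inj₂ e) = 3 + top , trans (suc₃-cube (residue top)) r , inj₁ (cong suc e)

-- The potential on G □ H: rows are the positions along a Hamiltonian path of G,
-- and (g , h) receives ρ (row of g) (class of h) for a row profile ρ.
module Product (G H : Graph) (spider : Spider H)
               (path : List (Fin (n G))) (uniq : Unique path) (link : Linked (Adj G) path)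
               (cover : ∀ g → g ∈ path) (g₀ : Fin (n G)) (ρ : ℕ → Pattern) where

  open Spider spider
  open Positions g₀

  V : Set
  V = Fin (n G) × Fin (n H)

  m : ℕ
  m = length path

  row : Fin (n G) → ℕ
  row g = position (cover g)

  node : ℕ → Fin (n G)
  node = nth path

  row-node : ∀ {i} → i < m → row (node i) ≡ i
  row-node {i} i<m = position-nth path uniq i i<m (cover (node i))

  everywhere : (Q : V → Set) → (∀ i h → i < m → Q (node i , h)) → ∀ v → Q v
  everywhere Q at-row (g , h) =
    subst (λ g′ → Q (g′ , h)) (nth-position (cover g)) (at-row (row g) h (position< (cover g)))

  Other : Fin (n H) → Set
  Other h = (h ≢ w) × (h ≢ y) × (h ≢ z)

  data Kind (h : Fin (n H)) : Set where
    is-w : h ≡ w → Kind h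
    is-y : h ≡ y → Kind h
    is-z : h ≡ z → Kind h
    other : Other h → Kind h

  kind : ∀ h → Kind h
  kind h with h ≟ w | h ≟ y | h ≟ z
  ... | yes h≡w | _ | _ = is-w h≡w
  ... | no _ | yes h≡y | _ = is-y h≡y
  ... | no _ | no _ | yes h≡z = is-z h≡z
  ... | no h≢w | no h≢y | no h≢z = other (h≢w , h≢y , h≢z)

  class : Fin (n H) → Class
  class h with kind h
  ... | is-w _ = W
  ... | is-y _ = Y
  ... | is-z _ = Z
  ... | other _ = X

  class-w : class w ≡ W
  class-w with kind w
  ... | is-w _ = refl
  ... | is-y w≡y = ⊥-elim (y≢w (sym w≡y))
  ... | is-z w≡z = ⊥-elim (z≢w (sym w≡z))
  ... | other (w≢w , _) = ⊥-elim (w≢w refl)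

  class-y : class y ≡ Y
  class-y with kind y
  ... | is-w y≡w = ⊥-elim (y≢w y≡w)
  ... | is-y _ = refl
  ... | is-z y≡z = ⊥-elim (y≢z y≡z)
  ... | other (_ , y≢y , _) = ⊥-elim (y≢y refl)

  class-z : class z ≡ Z
  class-z with kind z
  ... | is-w z≡w = ⊥-elim (z≢w z≡w)
  ... | is-y z≡y = ⊥-elim (y≢z (sym z≡y))
  ... | is-z _ = refl
  ... | other (_ , _ , z≢z) = ⊥-elim (z≢z refl)

  class-other : ∀ {h} → Other h → class h ≡ X
  class-other {h} (h≢w , h≢y , h≢z) with kind h
  ... | is-w h≡w = ⊥-elim (h≢w h≡w)
  ... | is-y h≡y = ⊥-elim (h≢y h≡y)
  ... | is-z h≡z = ⊥-elim (h≢z h≡z)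
  ... | other _ = refl

  w∼other : ∀ {h} → Other h → Adj H w h
  w∼other (h≢w , _ , h≢z) = w∼others _ h≢w h≢z

  x-other : Other x
  x-other = x≢w , x≢y , x≢z

  potential : V → ℤ₃
  potential (g , h) = ρ (row g) (class h)

  product-sym : ∀ {a b} → ProdAdj G H a b → ProdAdj G H b a
  product-sym (inj₁ (refl , h∼h′)) = inj₁ (refl , adj-sym H h∼h′)
  product-sym (inj₂ (refl , g∼g′)) = inj₂ (refl , adj-sym G g∼g′)

  _≟ᵥ_ : DecidableEquality V
  (g , h) ≟ᵥ (g′ , h′) with g ≟ g′ | h ≟ h′
  ... | yes refl | yes refl = yes refl
  ... | no g≢g′ | _ = no (λ e → g≢g′ (cong proj₁ e))
  ... | yes _ | no h≢h′ = no (λ e → h≢h′ (cong proj₂ e))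

  open PotentialColouring (ProdAdj G H) potential public using (colouring)
  open HubConnection (ProdAdj G H) product-sym _≟ᵥ_ potential public

  hub : V
  hub = node 0 , w

  potential-at : ∀ {i P h c} → i < m → ρ i ≡ P → class h ≡ c → potential (node i , h) ≡ P c
  potential-at i<m ρᵢ cl = trans (cong₂ ρ (row-node i<m) cl) (cong-app ρᵢ _)

  private
    rises-by-one : ∀ {a b} {pa pb : ℤ₃} → pa ≡ a → pb ≡ b → b ≡ suc₃ a → pb ≡ suc₃ pa
    rises-by-one refl refl rises = rises

  across : ∀ {i P h h′ c c′} → i < m → ρ i ≡ P → class h ≡ c → class h′ ≡ c′ →
           P c′ ≡ suc₃ (P c) → Adj H h h′ → Ascent (node i , h) (node i , h′)
  across i<m ρᵢ cl cl′ rises h∼h′ =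
    (inj₁ (refl , h∼h′) , rises-by-one (potential-at i<m ρᵢ cl) (potential-at i<m ρᵢ cl′) rises) ◅ ε

  up : ∀ {i P Q h c} → suc i < m → ρ i ≡ P → ρ (suc i) ≡ Q → class h ≡ c →
       Q c ≡ suc₃ (P c) → Ascent (node i , h) (node (suc i) , h)
  up {i} i+1<m ρᵢ ρᵢ₊₁ cl rises =
    (inj₂ (refl , nth-linked path link i i+1<m) ,
     rises-by-one (potential-at (<⇒≤ i+1<m) ρᵢ cl) (potential-at i+1<m ρᵢ₊₁ cl) rises) ◅ ε

  down : ∀ {i P Q h c} → suc i < m → ρ i ≡ P → ρ (suc i) ≡ Q → class h ≡ c →
         P c ≡ suc₃ (Q c) → Ascent (node (suc i) , h) (node i , h)
  down {i} i+1<m ρᵢ ρᵢ₊₁ cl rises =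
    (inj₂ (refl , adj-sym G (nth-linked path link i i+1<m)) ,
     rises-by-one (potential-at i+1<m ρᵢ₊₁ cl) (potential-at (<⇒≤ i+1<m) ρᵢ cl) rises) ◅ ε

  record Leaf (h : Fin (n H)) : Set where
    field
      leaf-class : Class
      class≡ : class h ≡ leaf-class
      mirrored : ∀ r → base r leaf-class ≡ mirror r
      w∼h : Adj H w h

  leaf-y : Leaf y
  leaf-y = record { leaf-class = Y ; class≡ = class-y ; mirrored = λ _ → refl ; w∼h = w∼others y y≢w y≢z }

  leaf-other : ∀ {h} → Other h → Leaf h
  leaf-other o = record { leaf-class = X ; class≡ = class-other o ; mirrored = λ _ → refl ; w∼h = w∼other o }

  -- The W column climbs to the
  -- top, where it turns into the leaf columns; these fall to the bottom row, where
  -- they turn back into W. The Z column climbs as well and is entered from y in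
  -- row 0 and left towards y at the top.
  module BaseBlock (top : ℕ) (top<m : top < m) (top-residue : residue top ≡ suc (suc zero))
                   (ρ-base : ∀ {i} → i ≤ top → ρ i ≡ base (residue i)) where

    ρ-bottom : ρ 0 ≡ base zero
    ρ-bottom = ρ-base z≤n

    ρ-top : ρ top ≡ base (suc (suc zero))
    ρ-top = trans (ρ-base ≤-refl) (cong base top-residue)

    0<m : 0 < m
    0<m = ≤-trans (s≤s z≤n) top<m

    rise : ∀ {h c i j} → class h ≡ c → (∀ r → base (suc₃ r) c ≡ suc₃ (base r c)) →
           i ≤ j → j ≤ top → Ascent (node i , h) (node j , h)
    rise cl rising i≤j j≤top =
      climb (λ k → node k , _) (λ k k<j → let k<top = ≤-trans k<j j≤top in
        up (≤-trans (s≤s k<top) top<m) (ρ-base (<⇒≤ k<top)) (ρ-base k<top) cl (rising (residue k))) i≤j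

    fall : ∀ {h} (l : Leaf h) {i j} → i ≤ j → j ≤ top → Ascent (node j , h) (node i , h)
    fall l i≤j j≤top =
      descend (λ k → node k , _) (λ k k<j → let k<top = ≤-trans k<j j≤top in
        down (≤-trans (s≤s k<top) top<m) (ρ-base (<⇒≤ k<top)) (ρ-base k<top) class≡ (falls (residue k))) i≤j
      where
        open Leaf l
        falls : ∀ r → base r leaf-class ≡ suc₃ (base (suc₃ r) leaf-class)
        falls r = trans (mirrored r) (trans (mirror-falls r) (cong suc₃ (sym (mirrored (suc₃ r)))))

    into-w : ∀ {i} → i ≤ top → Ascent hub (node i , w)
    into-w i≤top = rise class-w (λ _ → refl) z≤n i≤top

    into-leaf : ∀ {h} → Leaf h → ∀ {i} → i ≤ top → Ascent hub (node i , h)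
    into-leaf l i≤top =
      into-w ≤-refl ◅◅ across top<m ρ-top class-w class≡ (mirrored _) w∼h ◅◅ fall l i≤top ≤-refl
      where open Leaf l

    into-z : ∀ {i} → i ≤ top → Ascent hub (node i , z)
    into-z i≤top = into-leaf leaf-y z≤n ◅◅ across 0<m ρ-bottom class-y class-z refl y∼z ◅◅
                   rise class-z (λ _ → refl) z≤n i≤top

    out-leaf : ∀ {h} → Leaf h → ∀ {i} → i ≤ top → Ascent (node i , h) hub
    out-leaf l i≤top =
      fall l z≤n i≤top ◅◅ across 0<m ρ-bottom class≡ class-w (cong suc₃ (sym (mirrored _))) (adj-sym H w∼h)
      where open Leaf l

    out-w : ∀ {i} → i ≤ top → Ascent (node i , w) hub
    out-w i≤top = rise class-w (λ _ → refl) i≤top ≤-refl ◅◅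
                  across top<m ρ-top class-w class-y refl (w∼others y y≢w y≢z) ◅◅ out-leaf leaf-y ≤-refl

    out-z : ∀ {i} → i ≤ top → Ascent (node i , z) hub
    out-z i≤top = rise class-z (λ _ → refl) i≤top ≤-refl ◅◅
                  across top<m ρ-top class-z class-y refl (adj-sym H y∼z) ◅◅ out-leaf leaf-y ≤-refl

    into : ∀ h {i} → i ≤ top → Ascent hub (node i , h)
    into h with kind h
    ... | is-w refl = into-w
    ... | is-y refl = into-leaf leaf-y
    ... | is-z refl = into-z
    ... | other o = into-leaf (leaf-other o)

    out : ∀ h {i} → i ≤ top → Ascent (node i , h) hub
    out h with kind h
    ... | is-w refl = out-w
    ... | is-y refl = out-leaf leaf-y
    ... | is-z refl = out-z
    ... | other o = out-leaf (leaf-other o)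

  -- Row t is the ascending cycle x → w → y → z; it is
  -- entered from below in the X columns and left downwards in the Z column.
  module OneRowCap (top : ℕ) (t<m : suc top < m) (ρ-top : ρ top ≡ base (suc (suc zero))) (ρ-t : ρ (suc top) ≡ cap₁)
                   (into-top : ∀ h → Ascent hub (node top , h)) (out-top : ∀ h → Ascent (node top , h) hub) where

    into-other : ∀ {h} → Other h → Ascent hub (node (suc top) , h)
    into-other o = into-top _ ◅◅ up t<m ρ-top ρ-t (class-other o) refl

    into-w : Ascent hub (node (suc top) , w)
    into-w = into-other x-other ◅◅ across t<m ρ-t (class-other x-other) class-w refl (adj-sym H (w∼other x-other))

    into-y : Ascent hub (node (suc top) , y)
    into-y = into-w ◅◅ across t<m ρ-t class-w class-y refl (w∼others y y≢w y≢z)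

    into-z : Ascent hub (node (suc top) , z)
    into-z = into-y ◅◅ across t<m ρ-t class-y class-z refl y∼z

    out-z : Ascent (node (suc top) , z) hub
    out-z = down t<m ρ-top ρ-t class-z refl ◅◅ out-top z

    out-y : Ascent (node (suc top) , y) hub
    out-y = across t<m ρ-t class-y class-z refl y∼z ◅◅ out-z

    out-w : Ascent (node (suc top) , w) hub
    out-w = across t<m ρ-t class-w class-y refl (w∼others y y≢w y≢z) ◅◅ out-y

    out-other : ∀ {h} → Other h → Ascent (node (suc top) , h) hub
    out-other o = across t<m ρ-t (class-other o) class-w refl (adj-sym H (w∼other o)) ◅◅ out-w

    into : ∀ h → Ascent hub (node (suc top) , h)
    into h with kind h
    ... | is-w refl = into-w
    ... | is-y refl = into-y
    ... | is-z refl = into-z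
    ... | other o = into-other o

    out : ∀ h → Ascent (node (suc top) , h) hub
    out h with kind h
    ... | is-w refl = out-w
    ... | is-y refl = out-y
    ... | is-z refl = out-z
    ... | other o = out-other o

  -- The cycle w → y → y′ → w′ → x′ → x through
  -- both rows (primes mark row t + 1) joins everything except the Z column, which
  -- only has exits; it is entered only from below, if at all.
  module TwoRowCap (t : ℕ) (t+1<m : suc t < m) (ρ-t : ρ t ≡ cap₂ᵃ) (ρ-t+1 : ρ (suc t) ≡ cap₂ᵇ)
                   (into-w : Ascent hub (node t , w))
                   (out-other : ∀ {h} → Other h → Ascent (node t , h) hub) where

    t<m : t < m
    t<m = <⇒≤ t+1<m

    w∼y : Adj H w y
    w∼y = w∼others y y≢w y≢z

    into-y : Ascent hub (node t , y)
    into-y = into-w ◅◅ across t<m ρ-t class-w class-y refl w∼y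

    into-y′ : Ascent hub (node (suc t) , y)
    into-y′ = into-y ◅◅ up t+1<m ρ-t ρ-t+1 class-y refl

    into-w′ : Ascent hub (node (suc t) , w)
    into-w′ = into-y′ ◅◅ across t+1<m ρ-t+1 class-y class-w refl (adj-sym H w∼y)

    into-other′ : ∀ {h} → Other h → Ascent hub (node (suc t) , h)
    into-other′ o = into-w′ ◅◅ across t+1<m ρ-t+1 class-w (class-other o) refl (w∼other o)

    into-other : ∀ {h} → Other h → Ascent hub (node t , h)
    into-other o = into-other′ o ◅◅ down t+1<m ρ-t ρ-t+1 (class-other o) refl

    into-z′ : Ascent hub (node t , z) → Ascent hub (node (suc t) , z)
    into-z′ into-z = into-z ◅◅ up t+1<m ρ-t ρ-t+1 class-z refl

    out-other′ : ∀ {h} → Other h → Ascent (node (suc t) , h) hub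
    out-other′ o = down t+1<m ρ-t ρ-t+1 (class-other o) refl ◅◅ out-other o

    out-w′ : Ascent (node (suc t) , w) hub
    out-w′ = across t+1<m ρ-t+1 class-w (class-other x-other) refl (w∼other x-other) ◅◅ out-other′ x-other

    out-y′ : Ascent (node (suc t) , y) hub
    out-y′ = across t+1<m ρ-t+1 class-y class-w refl (adj-sym H w∼y) ◅◅ out-w′

    out-y : Ascent (node t , y) hub
    out-y = up t+1<m ρ-t ρ-t+1 class-y refl ◅◅ out-y′

    out-w : Ascent (node t , w) hub
    out-w = across t<m ρ-t class-w class-y refl w∼y ◅◅ out-y

    out-z : Ascent (node t , z) hub
    out-z = across t<m ρ-t class-z class-y refl (adj-sym H y∼z) ◅◅ out-y

    out-z′ : Ascent (node (suc t) , z) hub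
    out-z′ = across t+1<m ρ-t+1 class-z class-y refl (adj-sym H y∼z) ◅◅ out-y′

    out : ∀ h → Ascent (node t , h) hub
    out h with kind h
    ... | is-w refl = out-w
    ... | is-y refl = out-y
    ... | is-z refl = out-z
    ... | other o = out-other o

    out′ : ∀ h → Ascent (node (suc t) , h) hub
    out′ h with kind h
    ... | is-w refl = out-w′
    ... | is-y refl = out-y′
    ... | is-z refl = out-z′
    ... | other o = out-other′ o

    into : ∀ h → h ≢ z → Ascent hub (node t , h)
    into h h≢z with kind h
    ... | is-w refl = into-w
    ... | is-y refl = into-y
    ... | is-z h≡z = ⊥-elim (h≢z h≡z)
    ... | other o = into-other o

    into′ : ∀ h → h ≢ z → Ascent hub (node (suc t) , h)
    into′ h h≢z with kind h
    ... | is-w refl = into-w′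
    ... | is-y refl = into-y′
    ... | is-z h≡z = ⊥-elim (h≢z h≡z)
    ... | other o = into-other′ o

  -- In each,
  -- every vertex ascends to the hub and the hub ascends to every vertex, except
  -- for the Z column when there are no base rows, which is then a clique.

  module BaseOnly (top : ℕ) (m≡ : m ≡ suc top) (top-residue : residue top ≡ suc (suc zero))
                  (ρ-base : ∀ {i} → i ≤ top → ρ i ≡ base (residue i)) where

    open BaseBlock top (subst (top <_) (sym m≡) ≤-refl) top-residue ρ-base

    below : ∀ {i} → i < m → i ≤ top
    below i<m = ≤-pred (subst (_ <_) m≡ i<m)

    connected : TotalProperConnected (ProdAdj G H) colouring
    connected = hub-connected hub (λ _ → ⊥)
      (everywhere _ (λ i h i<m → out h (below i<m)))
      (everywhere _ (λ i h i<m → inj₁ (into h (below i<m))))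
      (λ _ _ ())

  module BaseAndOneRow (top : ℕ) (m≡ : m ≡ 2 + top) (top-residue : residue top ≡ suc (suc zero))
                       (ρ-base : ∀ {i} → i ≤ top → ρ i ≡ base (residue i)) (ρ-t : ρ (suc top) ≡ cap₁) where

    t<m : suc top < m
    t<m = subst (suc top <_) (sym m≡) ≤-refl

    module Base = BaseBlock top (<⇒≤ t<m) top-residue ρ-base
    module Cap = OneRowCap top t<m Base.ρ-top ρ-t (λ h → Base.into h ≤-refl) (λ h → Base.out h ≤-refl)

    connected : TotalProperConnected (ProdAdj G H) colouring
    connected = hub-connected hub (λ _ → ⊥) (everywhere _ out) (everywhere _ into) (λ _ _ ())
      where
        out : ∀ i h → i < m → Ascent (node i , h) hub
        out i h i<m with below-or-last (subst (i <_) m≡ i<m)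
        ... | inj₁ i≤top = Base.out h i≤top
        ... | inj₂ refl = Cap.out h

        into : ∀ i h → i < m → Ascent hub (node i , h) ⊎ ⊥
        into i h i<m with below-or-last (subst (i <_) m≡ i<m)
        ... | inj₁ i≤top = inj₁ (Base.into h i≤top)
        ... | inj₂ refl = inj₁ (Cap.into h)

  module BaseAndTwoRows (top : ℕ) (m≡ : m ≡ 3 + top) (top-residue : residue top ≡ suc (suc zero))
                        (ρ-base : ∀ {i} → i ≤ top → ρ i ≡ base (residue i))
                        (ρ-t : ρ (suc top) ≡ cap₂ᵃ) (ρ-t+1 : ρ (2 + top) ≡ cap₂ᵇ) where

    t+1<m : 2 + top < m
    t+1<m = subst (2 + top <_) (sym m≡) ≤-refl

    t<m : suc top < m
    t<m = <⇒≤ t+1<m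

    module Base = BaseBlock top (<⇒≤ t<m) top-residue ρ-base

    into-z : Ascent hub (node (suc top) , z)
    into-z = Base.into z ≤-refl ◅◅ up t<m Base.ρ-top ρ-t class-z refl

    module Cap = TwoRowCap (suc top) t+1<m ρ-t ρ-t+1
      (Base.into w ≤-refl ◅◅ up t<m Base.ρ-top ρ-t class-w refl)
      (λ o → down t<m Base.ρ-top ρ-t (class-other o) refl ◅◅ Base.out _ ≤-refl)

    connected : TotalProperConnected (ProdAdj G H) colouring
    connected = hub-connected hub (λ _ → ⊥) (everywhere _ out) (everywhere _ into) (λ _ _ ())
      where
        out : ∀ i h → i < m → Ascent (node i , h) hub
        out i h i<m with below-or-last (subst (i <_) m≡ i<m)
        ... | inj₂ refl = Cap.out′ h
        ... | inj₁ i≤top+1 with below-or-last (s≤s i≤top+1)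
        ...   | inj₁ i≤top = Base.out h i≤top
        ...   | inj₂ refl = Cap.out h

        into : ∀ i h → i < m → Ascent hub (node i , h) ⊎ ⊥
        into i h i<m with h ≟ z | below-or-last (subst (i <_) m≡ i<m)
        ... | yes refl | inj₂ refl = inj₁ (Cap.into-z′ into-z)
        ... | no h≢z | inj₂ refl = inj₁ (Cap.into′ h h≢z)
        ... | h≟z | inj₁ i≤top+1 with h≟z | below-or-last (s≤s i≤top+1)
        ...   | _ | inj₁ i≤top = inj₁ (Base.into h i≤top)
        ...   | yes refl | inj₂ refl = inj₁ into-z
        ...   | no h≢z | inj₂ refl = inj₁ (Cap.into h h≢z)

  -- m = 2: the two cap rows alone; the Z column consists of two adjacent vertices
  module TwoRowsOnly (m≡ : m ≡ 2) (ρ-0 : ρ 0 ≡ cap₂ᵃ) (ρ-1 : ρ 1 ≡ cap₂ᵇ) where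

    1<m : 1 < m
    1<m = subst (1 <_) (sym m≡) ≤-refl

    module Cap = TwoRowCap 0 1<m ρ-0 ρ-1 ε
      (λ o → across (<⇒≤ 1<m) ρ-0 (class-other o) class-w refl (adj-sym H (w∼other o)))

    InZ : V → Set
    InZ v = proj₂ v ≡ z

    connected : TotalProperConnected (ProdAdj G H) colouring
    connected = hub-connected hub InZ (everywhere _ out) (everywhere _ into) clique
      where
        out : ∀ i h → i < m → Ascent (node i , h) hub
        out i h i<m with below-or-last (subst (i <_) m≡ i<m)
        ... | inj₁ z≤n = Cap.out h
        ... | inj₂ refl = Cap.out′ h

        into : ∀ i h → i < m → Ascent hub (node i , h) ⊎ InZ (node i , h)
        into i h i<m with h ≟ z | below-or-last (subst (i <_) m≡ i<m)
        ... | yes h≡z | _ = inj₂ h≡z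
        ... | no h≢z | inj₁ z≤n = inj₁ (Cap.into h h≢z)
        ... | no h≢z | inj₂ refl = inj₁ (Cap.into′ h h≢z)

        clique : ∀ u v → InZ u → InZ v → u ≢ v → ProdAdj G H u v
        clique (g , _) (g′ , _) refl refl u≢v =
          inj₂ (refl , two-vertex-complete G m≡ link cover g g′ (λ g≡g′ → u≢v (cong (_, z) g≡g′)))

-- Lower bound: a total proper path between two distinct non-adjacent vertices has
-- an internal vertex whose colour and the colours of its two path edges are
-- pairwise different, so fewer than three colours never suffice.
no-three-distinct : ∀ {j} → j < 3 → (a b c : Fin j) → a ≢ b → b ≢ c → a ≢ c → ⊥
no-three-distinct j<3 a b c a≢b b≢c a≢c
  with pigeonhole j<3 (λ { zero → a ; (suc zero) → b ; (suc (suc zero)) → c })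
... | zero , suc zero , _ , a≡b = a≢b a≡b
... | zero , suc (suc zero) , _ , a≡c = a≢c a≡c
... | suc zero , suc (suc zero) , _ , b≡c = b≢c b≡c
... | zero , zero , () , _
... | suc zero , zero , () , _
... | suc zero , suc zero , s≤s () , _
... | suc (suc zero) , zero , () , _
... | suc (suc zero) , suc zero , s≤s () , _
... | suc (suc zero) , suc (suc zero) , s≤s (s≤s ()) , _

at-least-three-colours : ∀ {V : Set} (A : V → V → Set) {u v : V} → u ≢ v → ¬ A u v →
                         ∀ j → j < 3 → ¬ Σ (TotalColoring A j) (TotalProperConnected A)
at-least-three-colours A {u} {v} u≢v u≁v j j<3 (c , tpc) with tpc u v
... | [] , () , _
... | a ∷ [] , (refl , a≡v , _) , _ = u≢v a≡v
... | a ∷ b ∷ [] , (refl , refl , _ , (u∼v ∷ _)) , _ = u≁v u∼v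
... | a ∷ b ∷ d ∷ _ , _ , (e≢e , v≢e₁ , v≢e₂ , _) , _ =
  no-three-distinct j<3 _ _ _ e≢e (λ e → v≢e₂ (sym e)) (λ e → v≢e₁ (sym e))

distinct-pair : ∀ {k} → 2 ≤ k → Σ (Fin k) λ a → Σ (Fin k) λ b → a ≢ b
distinct-pair {suc zero} (s≤s ())
distinct-pair {suc (suc k)} _ = zero , suc zero , λ ()

upper-bound : (G H : Graph) → Spider H → Nontrivial G → Traceable G →
              Σ (TotalColoring (ProdAdj G H) 3) (TotalProperConnected (ProdAdj G H))
upper-bound G H sp two (path , uniq , link , cover) = by-shape (length-cases (length path) at-least-two)
  where
    g₀ g₁ : Fin (n G)
    g₀ = proj₁ (distinct-pair two)
    g₁ = proj₁ (proj₂ (distinct-pair two))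

    at-least-two : 2 ≤ length path
    at-least-two = Counting.length-≤-of-⊆ ((proj₂ (proj₂ (distinct-pair two)) ∷ []) ∷ [] ∷ [])
                     (λ { (here refl) → cover g₀ ; (there (here refl)) → cover g₁ })

    by-shape : Shape (length path) → Σ (TotalColoring (ProdAdj G H) 3) (TotalProperConnected (ProdAdj G H))
    by-shape (inj₁ m≡2) =
      let open Product G H sp path uniq link cover g₀ two-row-cap
      in colouring , TwoRowsOnly.connected m≡2 refl refl
    by-shape (inj₂ (top , top-residue , inj₁ m≡)) =
      let open Product G H sp path uniq link cover g₀ (λ i → base (residue i))
      in colouring , BaseOnly.connected top m≡ top-residue (λ _ → refl)
    by-shape (inj₂ (top , top-residue , inj₂ (inj₁ m≡))) =
      let open Product G H sp path uniq link cover g₀ (profile (suc top) (λ _ → cap₁))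
      in colouring , BaseAndOneRow.connected top m≡ top-residue (λ i≤top → profile-base (s≤s i≤top))
                                             (profile-cap (suc top) _ 0)
    by-shape (inj₂ (top , top-residue , inj₂ (inj₂ m≡))) =
      let open Product G H sp path uniq link cover g₀ (profile (suc top) two-row-cap)
      in colouring , BaseAndTwoRows.connected top m≡ top-residue (λ i≤top → profile-base (s≤s i≤top))
                                              (profile-cap (suc top) _ 0) (profile-cap (suc top) _ 1)

theorem3p3 : (G H : Graph) → Nontrivial G → Traceable G → ConnectedG H → MaxDegreeIsOrderMinus2 H → TpcEquals (ProdAdj G H) 3
theorem3p3 G H two traceable connected Δ =
  upper-bound G H sp two traceable , at-least-three-colours (ProdAdj G H) u≢v u≁v
  where
    sp : Spider H
    sp = spider H connected Δ
    open Spider sp using (w; z; z≢w)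

    a b : Fin (n G)
    a = proj₁ (distinct-pair two)
    b = proj₁ (proj₂ (distinct-pair two))

    a≢b : a ≢ b
    a≢b = proj₂ (proj₂ (distinct-pair two))

    u≢v : (a , w) ≢ (b , z)
    u≢v e = a≢b (cong proj₁ e)

    u≁v : ¬ ProdAdj G H (a , w) (b , z)
    u≁v (inj₁ (a≡b , _)) = a≢b a≡b
    u≁v (inj₂ (w≡z , _)) = z≢w (sym w≡z)
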